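{- Let $x,y,z,m,n$ be positive integers with $x>y\ge 1$, $m>n\ge 1$, $\gcd(m,n)=1$, $m$ odd, $n$ even, $1\le z\le x+y$, $z\ne 2$, $\nu_2(x)=\nu_2(y)$, satisfying $$\varphi\left(z\frac{x^{m}+y^{m}}{x+y}\right)=z\frac{x^{n}-y^{n}}{x+y}.$$ Then $$\log x<1.38+\sum_{\substack{p \text{ prime},\ p\geq 7\\ p\mid z\frac{x^{m}+y^{m}}{x+y}}}\frac{1}{p}.$$
   Context: $\varphi$ is Euler's totient function; $\nu_2(k)$ is the exponent of $2$ in $k$. -}

module Defs where

open import Data.Nat as ℕ using (ℕ; zero; suc; _+_; _*_; _≤?_; _≟_)
open import Data.Nat.GCD using (gcd)
open import Data.Nat.Divisibility using (_∣_; _∣?_)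
open import Data.Nat.Primality using (Prime; prime?)
open import Data.Integer using (+_)
open import Data.Rational as ℚ using (ℚ; _/_; 0ℚ; 1ℚ)
open import Data.List using (List; filter; map; length; upTo; foldr)
open import Data.Product using (∃)
open import Relation.Nullary.Decidable using (_×-dec_; yes; no)

φ : ℕ → ℕ
φ n = length (filter (λ k → gcd k n ≟ 1) (map suc (upTo n)))

-- 2-adic valuation ν₂ (with ν₂ 0 = 0 by convention; only used on positive integers)
ν₂-fuel : ℕ → ℕ → ℕ
ν₂-fuel zero    n = 0
ν₂-fuel (suc f) zero = 0
ν₂-fuel (suc f) (suc k) with 2 ∣? suc k
... | yes _ = suc (ν₂-fuel f (suc k ℕ./ 2))
... | no _  = 0

ν₂ : ℕ → ℕ
ν₂ n = ν₂-fuel n n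

-- natural-number division by b (b > 0 in all uses; a div 0 = 0)
_div_ : ℕ → ℕ → ℕ
a div zero  = 0
a div suc b = a ℕ./ suc b

-- 1/p as a rational (1/0 := 0, never used)
inv : ℕ → ℚ
inv zero    = 0ℚ
inv (suc k) = + 1 / suc k

-- Σ_{p prime, p ≥ 7, p ∣ N} 1/p   (primes dividing N > 0 are ≤ N)
sumInvPrimes≥7 : ℕ → ℚ
sumInvPrimes≥7 N =
  foldr (λ p s → inv p ℚ.+ s) 0ℚ
    (filter (λ p → prime? p ×-dec (7 ≤? p ×-dec p ∣? N)) (upTo (suc N)))

expTerm : ℚ → ℕ → ℚ
expTerm c zero    = 1ℚ
expTerm c (suc k) = expTerm c k ℚ.* c ℚ.* inv (suc k)

expPartial : ℚ → ℕ → ℚ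
expPartial c zero    = 0ℚ
expPartial c (suc N) = expPartial c N ℚ.+ expTerm c N

-- "log x < c" for a positive integer x and a rational c ≥ 0, i.e. x < exp c.
-- Since c ≥ 0 the partial sums of the series increase strictly to exp c,
-- so x < exp c iff some partial sum exceeds x.
LogLt : ℕ → ℚ → Set
LogLt x c = ∃ λ N → (+ x / 1) ℚ.< expPartial c N

c138 : ℚ
c138 = + 138 / 100

module Submission where

-- Let N = z·(x^m + y^m)/(x + y).  The totient equation gives
-- φ(N) = z·(x^n − y^n)/(x + y), and since x·(x^n − y^n) ≤ x^{n+1} ≤ x^m we get
-- x·φ(N) ≤ N, i.e.  x ≤ N/φ(N) = ∏_{p ∣ N} p/(p − 1).  Writing
-- p/(p − 1) = p²/(p² − 1) · (p + 1)/p for p ≥ 7, the first factors are bounded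
-- over all primes by the Euler product ∏_{p<7} p/(p − 1) · ∏_{p≥7} p²/(p² − 1)
-- ≤ 99/25, and ∏ (1 + 1/p) ≤ exp(Σ 1/p), while 99/25 < exp(1.38).

module Counting where

  open import Defs using (φ)
  open import Data.Nat
  open import Data.Nat.Properties
  open import Data.Nat.Divisibility
  open import Data.Nat.GCD using (gcd)
  open import Data.Nat.Tactic.RingSolver using (solve-∀)
  open import Data.Bool using (Bool; true; false; _∧_; not; if_then_else_)
  open import Data.Bool.Properties using (∧-zeroʳ; ∧-identityʳ)
  open import Data.List using (List; []; _∷_; _∷ʳ_; filter; map; length; upTo; foldr)
  open import Data.List.Properties using (upTo-∷ʳ; map-++)
  open import Relation.Nullary using (does)
  open import Relation.Nullary.Decidable using (dec-true; dec-false)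
  open import Relation.Unary using (Decidable; Pred)
  open import Relation.Binary.PropositionalEquality

  ⟦_⟧ : Bool → ℕ
  ⟦ b ⟧ = if b then 1 else 0

  count : (ℕ → Bool) → ℕ → ℕ
  count b zero    = 0
  count b (suc n) = count b n + ⟦ b (suc n) ⟧

  count-ext : ∀ (b c : ℕ → Bool) n → (∀ k → 1 ≤ k → k ≤ n → b k ≡ c k) →
              count b n ≡ count c n
  count-ext b c zero    h = refl
  count-ext b c (suc n) h =
    cong₂ _+_ (count-ext b c n (λ k 1≤k k≤n → h k 1≤k (m≤n⇒m≤1+n k≤n)))
              (cong ⟦_⟧ (h (suc n) (s≤s z≤n) ≤-refl))

  count-true : ∀ n → count (λ _ → true) n ≡ n
  count-true zero    = refl
  count-true (suc n) = trans (cong (_+ 1) (count-true n)) (+-comm n 1)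

  count-false : ∀ (b : ℕ → Bool) n → (∀ k → 1 ≤ k → k ≤ n → b k ≡ false) → count b n ≡ 0
  count-false b zero    h = refl
  count-false b (suc n) h
    rewrite h (suc n) (s≤s z≤n) ≤-refl | count-false b n (λ k 1≤k k≤n → h k 1≤k (m≤n⇒m≤1+n k≤n)) = refl

  count-split : ∀ (b c : ℕ → Bool) n →
                count b n ≡ count (λ k → b k ∧ not (c k)) n + count (λ k → b k ∧ c k) n
  count-split b c zero    = refl
  count-split b c (suc n) = begin
      count b n + ⟦ b (suc n) ⟧
    ≡⟨ cong₂ _+_ (count-split b c n) (indicator-split (b (suc n)) (c (suc n))) ⟩
      (count b¬c n + count bc n) + (⟦ b (suc n) ∧ not (c (suc n)) ⟧ + ⟦ b (suc n) ∧ c (suc n) ⟧)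
    ≡⟨ interchange (count b¬c n) _ _ _ ⟩
      count b¬c (suc n) + count bc (suc n) ∎
    where
    open ≡-Reasoning
    b¬c bc : ℕ → Bool
    b¬c k = b k ∧ not (c k)
    bc  k = b k ∧ c k
    indicator-split : ∀ u v → ⟦ u ⟧ ≡ ⟦ u ∧ not v ⟧ + ⟦ u ∧ v ⟧
    indicator-split true  true  = refl
    indicator-split true  false = refl
    indicator-split false _     = refl
    interchange : ∀ a b c d → (a + b) + (c + d) ≡ (a + c) + (b + d)
    interchange = solve-∀

  count-+ : ∀ (b : ℕ → Bool) m n → count b (m + n) ≡ count b m + count (λ i → b (m + i)) n
  count-+ b m zero    rewrite +-identityʳ m = sym (+-identityʳ _)
  count-+ b m (suc n) rewrite +-suc m n =
    trans (cong (_+ ⟦ b (suc (m + n)) ⟧) (count-+ b m n)) (+-assoc (count b m) _ _)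

  count-multiples : ∀ (b : ℕ → Bool) d t → .{{NonZero d}} →
                    count (λ k → b k ∧ does (d ∣? k)) (t * d) ≡ count (λ j → b (j * d)) t
  count-multiples b d@(suc r) zero    = refl
  count-multiples b d@(suc r) (suc t) = begin
      count g (d + t * d)
    ≡⟨ cong (count g) (+-comm d (t * d)) ⟩
      count g (t * d + suc r)
    ≡⟨ count-+ g (t * d) (suc r) ⟩
      count g (t * d) + (count (λ i → g (t * d + i)) r + ⟦ g (t * d + d) ⟧)
    ≡⟨ cong₂ (λ u v → u + (v + ⟦ g (t * d + d) ⟧)) (count-multiples b d t) no-multiple-inside ⟩
      count (λ j → b (j * d)) t + (0 + ⟦ g (t * d + d) ⟧)
    ≡⟨ cong (λ v → count (λ j → b (j * d)) t + ⟦ v ⟧) last-multiple ⟩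
      count (λ j → b (j * d)) (suc t) ∎
    where
    open ≡-Reasoning
    g : ℕ → Bool
    g k = b k ∧ does (d ∣? k)
    no-multiple-inside : count (λ i → g (t * d + i)) r ≡ 0
    no-multiple-inside = count-false _ r λ where
      (suc i) _ i≤r → trans (cong (b (t * d + suc i) ∧_)
                               (dec-false (d ∣? (t * d + suc i))
                                  λ d∣ → <⇒≱ (s≤s i≤r) (∣⇒≤ (∣m+n∣m⇒∣n d∣ (n∣m*n t)))))
                            (∧-zeroʳ _)
    last-multiple : g (t * d + d) ≡ b (d + t * d)
    last-multiple rewrite +-comm (t * d) d | dec-true (d ∣? (d + t * d)) (n∣m*n (suc t)) =
      ∧-identityʳ _

  prod : (ℕ → Bool) → (ℕ → ℕ) → ℕ → ℕ
  prod b f zero    = 1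
  prod b f (suc M) = prod b f M * (if b M then f M else 1)

  prod-ext : ∀ (b c : ℕ → Bool) f M → (∀ p → p < M → b p ≡ c p) → prod b f M ≡ prod c f M
  prod-ext b c f zero    h = refl
  prod-ext b c f (suc M) h =
    cong₂ (λ u v → u * (if v then f M else 1))
          (prod-ext b c f M (λ p p<M → h p (m<n⇒m<1+n p<M))) (h M ≤-refl)

  prod-pos : ∀ (b : ℕ → Bool) f M → (∀ p → b p ≡ true → 1 ≤ f p) → 1 ≤ prod b f M
  prod-pos b f zero    h = ≤-refl
  prod-pos b f (suc M) h = *-mono-≤ (prod-pos b f M h) (factor-pos (b M) (h M))
    where
    factor-pos : ∀ v → (v ≡ true → 1 ≤ f M) → 1 ≤ (if v then f M else 1)
    factor-pos true  h = h refl
    factor-pos false h = ≤-refl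

  prod-split : ∀ (b s : ℕ → Bool) f g M →
               prod b (λ p → if s p then f p * g p else f p) M ≡ prod b f M * prod (λ p → b p ∧ s p) g M
  prod-split b s f g zero    = refl
  prod-split b s f g (suc M) =
    trans (cong (_* (if b M then (if s M then f M * g M else f M) else 1)) (prod-split b s f g M))
          (step (b M) (s M) (prod b f M) _ (f M) (g M))
    where
    step : ∀ u v A B x y → A * B * (if u then (if v then x * y else x) else 1)
                         ≡ A * (if u then x else 1) * (B * (if u ∧ v then y else 1))
    step true  true  A B x y = e A B x y
      where
      e : ∀ A B x y → A * B * (x * y) ≡ A * x * (B * y)
      e = solve-∀
    step true  false A B x y = e A B x
      where
      e : ∀ A B x → A * B * x ≡ A * x * (B * 1)
      e = solve-∀
    step false _     A B x y = e A B
      where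
      e : ∀ A B → A * B * 1 ≡ A * 1 * (B * 1)
      e = solve-∀

  -- If the ratios f p / g p (≥ 1 on R) are multiplied over P ⊆ R, the result
  -- is at most the product over R:  ∏_P f · ∏_R g ≤ ∏_R f · ∏_P g.
  prod-ratio-subset : ∀ (P R : ℕ → Bool) f g M →
                      (∀ p → P p ≡ true → R p ≡ true) → (∀ p → R p ≡ true → g p ≤ f p) →
                      prod P f M * prod R g M ≤ prod R f M * prod P g M
  prod-ratio-subset P R f g zero    P⊆R g≤f = ≤-refl
  prod-ratio-subset P R f g (suc M) P⊆R g≤f =
    step (P M) (R M) (P⊆R M) (g≤f M) (prod-ratio-subset P R f g M P⊆R g≤f)
    where
    a b c d : ℕ
    a = prod P f M
    b = prod R g M
    c = prod R f M
    d = prod P g M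
    step : ∀ u v → (u ≡ true → v ≡ true) → (v ≡ true → g M ≤ f M) → a * b ≤ c * d →
           a * (if u then f M else 1) * (b * (if v then g M else 1))
             ≤ c * (if v then f M else 1) * (d * (if u then g M else 1))
    step true true _ _ ab≤cd = begin
        a * f M * (b * g M) ≡⟨ shuffle a b (f M) (g M) ⟩
        a * b * (f M * g M) ≤⟨ *-monoˡ-≤ (f M * g M) ab≤cd ⟩
        c * d * (f M * g M) ≡⟨ shuffle c d (f M) (g M) ⟨
        c * f M * (d * g M) ∎
      where
      open ≤-Reasoning
      shuffle : ∀ a b x y → a * x * (b * y) ≡ a * b * (x * y)
      shuffle = solve-∀
    step true false u⇒v _ _ with () ← u⇒v refl
    step false true _ g≤f ab≤cd = begin
        a * 1 * (b * g M) ≡⟨ shuffle a b (g M) ⟩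
        a * b * g M       ≤⟨ *-mono-≤ ab≤cd (g≤f refl) ⟩
        c * d * f M       ≡⟨ shuffle′ c d (f M) ⟨
        c * f M * (d * 1) ∎
      where
      open ≤-Reasoning
      shuffle : ∀ a b y → a * 1 * (b * y) ≡ a * b * y
      shuffle = solve-∀
      shuffle′ : ∀ c d x → c * x * (d * 1) ≡ c * d * x
      shuffle′ = solve-∀
    step false false _ _ ab≤cd = begin
        a * 1 * (b * 1) ≡⟨ unit a b ⟩
        a * b           ≤⟨ ab≤cd ⟩
        c * d           ≡⟨ unit c d ⟨
        c * 1 * (d * 1) ∎
      where
      open ≤-Reasoning
      unit : ∀ a b → a * 1 * (b * 1) ≡ a * b
      unit = solve-∀

  -- The ratio ∏_{p<M} f p / ∏_{p<M} g p grows with M when g ≤ f: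
  --   ∏_{<M} f · ∏_{<M+k} g ≤ ∏_{<M+k} f · ∏_{<M} g.
  prod-ratio-mono : ∀ (R : ℕ → Bool) f g M k → (∀ p → R p ≡ true → g p ≤ f p) →
                    prod R f M * prod R g (M + k) ≤ prod R f (M + k) * prod R g M
  prod-ratio-mono R f g M zero    g≤f rewrite +-identityʳ M = ≤-refl
  prod-ratio-mono R f g M (suc k) g≤f rewrite +-suc M k = step (R (M + k)) (g≤f (M + k))
    where
    a b c d : ℕ
    a = prod R f M
    b = prod R g (M + k)
    c = prod R f (M + k)
    d = prod R g M
    ih : a * b ≤ c * d
    ih = prod-ratio-mono R f g M k g≤f
    step : ∀ v → (v ≡ true → g (M + k) ≤ f (M + k)) →
           a * (b * (if v then g (M + k) else 1)) ≤ c * (if v then f (M + k) else 1) * d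
    step true g≤f′ = begin
        a * (b * g (M + k)) ≡⟨ *-assoc a b _ ⟨
        a * b * g (M + k)   ≤⟨ *-mono-≤ ih (g≤f′ refl) ⟩
        c * d * f (M + k)   ≡⟨ shuffle c d _ ⟩
        c * f (M + k) * d   ∎
      where
      open ≤-Reasoning
      shuffle : ∀ c d x → c * d * x ≡ c * x * d
      shuffle = solve-∀
    step false _ = begin
        a * (b * 1) ≡⟨ cong (a *_) (*-identityʳ b) ⟩
        a * b       ≤⟨ ih ⟩
        c * d       ≡⟨ cong (_* d) (*-identityʳ c) ⟨
        c * 1 * d   ∎
      where open ≤-Reasoning

  listProd : (ℕ → ℕ) → List ℕ → ℕ
  listProd f = foldr (λ p r → f p * r) 1

  module _ {ℓ} {P : Pred ℕ ℓ} (P? : Decidable P) where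

    listProd-filter-snoc : ∀ f xs a →
      listProd f (filter P? (xs ∷ʳ a)) ≡ listProd f (filter P? xs) * (if does (P? a) then f a else 1)
    listProd-filter-snoc f [] a with does (P? a)
    ... | true  = trans (*-identityʳ (f a)) (sym (+-identityʳ (f a)))
    ... | false = refl
    listProd-filter-snoc f (x ∷ xs) a with does (P? x)
    ... | true  = trans (cong (f x *_) (listProd-filter-snoc f xs a)) (sym (*-assoc (f x) _ _))
    ... | false = listProd-filter-snoc f xs a

    listProd-filter-upTo : ∀ f M → listProd f (filter P? (upTo M)) ≡ prod (λ p → does (P? p)) f M
    listProd-filter-upTo f zero    = refl
    listProd-filter-upTo f (suc M) = begin
        listProd f (filter P? (upTo (suc M)))     ≡⟨ cong (λ l → listProd f (filter P? l)) (upTo-∷ʳ M) ⟨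
        listProd f (filter P? (upTo M ∷ʳ M))      ≡⟨ listProd-filter-snoc f (upTo M) M ⟩
        listProd f (filter P? (upTo M)) * _       ≡⟨ cong (_* _) (listProd-filter-upTo f M) ⟩
        prod (λ p → does (P? p)) f (suc M)        ∎
      where open ≡-Reasoning

    length-filter-snoc : ∀ xs a → length (filter P? (xs ∷ʳ a)) ≡ length (filter P? xs) + ⟦ does (P? a) ⟧
    length-filter-snoc [] a with does (P? a)
    ... | true  = refl
    ... | false = refl
    length-filter-snoc (x ∷ xs) a with does (P? x)
    ... | true  = cong suc (length-filter-snoc xs a)
    ... | false = length-filter-snoc xs a

    length-filter-range : ∀ n → length (filter P? (map suc (upTo n))) ≡ count (λ k → does (P? k)) n
    length-filter-range zero    = refl
    length-filter-range (suc n) = begin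
        length (filter P? (map suc (upTo (suc n))))   ≡⟨ cong (λ l → length (filter P? (map suc l))) (upTo-∷ʳ n) ⟨
        length (filter P? (map suc (upTo n ∷ʳ n)))    ≡⟨ cong (λ l → length (filter P? l)) (map-++ suc (upTo n) (n ∷ [])) ⟩
        length (filter P? (map suc (upTo n) ∷ʳ suc n)) ≡⟨ length-filter-snoc (map suc (upTo n)) (suc n) ⟩
        length (filter P? (map suc (upTo n))) + _     ≡⟨ cong (_+ _) (length-filter-range n) ⟩
        count (λ k → does (P? k)) (suc n)             ∎
      where open ≡-Reasoning

  φ≡count : ∀ n → φ n ≡ count (λ k → does (gcd k n ≟ 1)) n
  φ≡count n = length-filter-range (λ k → gcd k n ≟ 1) n

-- Euler's product formula in integral form:
--   φ n · ∏_{p ∣ n} p = n · ∏_{p ∣ n} (p − 1),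
-- proved by a Legendre sieve: remove, one prime divisor M of n at a time,
-- the multiples of M from [1 .. n].
module ProductFormula where

  open Counting
  open import Defs using (φ)
  open import Data.Nat
  open import Data.Nat.Properties
  open import Data.Nat.Divisibility
  open import Data.Nat.GCD
  open import Data.Nat.Primality
  open import Data.Nat.Primality.Factorisation using (factorise; PrimeFactorisation)
  open import Data.Nat.ListAction using (product)
  open import Data.Nat.Tactic.RingSolver using (solve-∀)
  open import Data.Bool using (Bool; true; false; _∧_; not)
  open import Data.Bool.Properties using (∧-zeroʳ; ∧-identityʳ)
  open import Data.List using (List; _∷_)
  open import Data.List.Relation.Unary.All using (All; _∷_)
  open import Data.Product using (_×_; _,_; ∃-syntax)
  open import Data.Sum using (inj₁; inj₂)
  open import Relation.Nullary using (¬_; Dec; yes; no; does; contradiction)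
  open import Relation.Nullary.Decidable using (dec-true)
  open import Relation.Binary.PropositionalEquality
  open import Function using (id)

  prime⇒≥2 : ∀ {p} → Prime p → 2 ≤ p
  prime⇒≥2 {p} pp = nonTrivial⇒n>1 p {{prime⇒nonTrivial pp}}

  prime-factor : ∀ g → 2 ≤ g → ∃[ p ] (Prime p × p ∣ g)
  prime-factor 1 (s≤s ())
  prime-factor g@(suc (suc _)) _ = first (factors fac) (isFactorisation fac) (factorsPrime fac)
    where
    open PrimeFactorisation
    fac : PrimeFactorisation g
    fac = factorise g
    first : (ps : List ℕ) → g ≡ product ps → All Prime ps → ∃[ p ] (Prime p × p ∣ g)
    first (p ∷ ps) g≡ (pp ∷ _) = p , pp , subst (p ∣_) (sym g≡) (m∣m*n (product ps))

  primeDivisor : ℕ → ℕ → Bool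
  primeDivisor n p = does (prime? p) ∧ does (p ∣? n)

  primeDivisor-sound : ∀ n p → primeDivisor n p ≡ true → Prime p × p ∣ n
  primeDivisor-sound n p with prime? p | p ∣? n
  ... | yes pp | yes p∣n = λ _ → pp , p∣n
  ... | yes _  | no _    = λ ()
  ... | no _   | _       = λ ()

  -- avoids n M k: no prime divisor p < M of n divides k (the sieve after
  -- the primes below M have been processed).
  avoids : ℕ → ℕ → ℕ → Bool
  avoids n zero    k = true
  avoids n (suc M) k = avoids n M k ∧ not (primeDivisor n M ∧ does (M ∣? k))

  prime-cancel : ∀ {p q} j → Prime p → Prime q → p < q → does (p ∣? (j * q)) ≡ does (p ∣? j)
  prime-cancel {p} {q} j pp pq p<q with p ∣? (j * q) | p ∣? j
  ... | yes _   | yes _  = refl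
  ... | no p∤jq | yes p∣j = contradiction (∣m⇒∣m*n q p∣j) p∤jq
  ... | no _    | no _   = refl
  ... | yes p∣jq | no p∤j with euclidsLemma j q pp p∣jq
  ...   | inj₁ p∣j = contradiction p∣j p∤j
  ...   | inj₂ p∣q with prime⇒irreducible pq p∣q
  ...     | inj₁ refl = contradiction pp ¬prime[1]
  ...     | inj₂ refl = contradiction p<q (<-irrefl refl)

  primeDivisor-mul : ∀ {q} → Prime q → ∀ t p → p < q → primeDivisor (t * q) p ≡ primeDivisor t p
  primeDivisor-mul pq t p p<q with prime? p
  ... | yes pp = prime-cancel t pp pq p<q
  ... | no _   = refl

  avoids-mulʳ : ∀ {q} → Prime q → ∀ M → M ≤ q → ∀ n j → avoids n M (j * q) ≡ avoids n M j
  avoids-mulʳ pq zero    M≤q n j = refl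
  avoids-mulʳ pq (suc M) M<q n j with prime? M
  ... | yes pM = cong₂ (λ u v → u ∧ not (does (M ∣? n) ∧ v))
                       (avoids-mulʳ pq M (<⇒≤ M<q) n j) (prime-cancel j pM pq M<q)
  ... | no _   = cong (λ u → u ∧ true) (avoids-mulʳ pq M (<⇒≤ M<q) n j)

  avoids-mulˡ : ∀ {q} → Prime q → ∀ M → M ≤ q → ∀ t k → avoids (t * q) M k ≡ avoids t M k
  avoids-mulˡ pq zero    M≤q t k = refl
  avoids-mulˡ pq (suc M) M<q t k =
    cong₂ (λ u v → u ∧ not (v ∧ does (M ∣? k)))
          (avoids-mulˡ pq M (<⇒≤ M<q) t k) (primeDivisor-mul pq t M M<q)

  count-avoiding-multiples : ∀ {M} → Prime M → ∀ t →
    count (λ k → avoids (t * M) M k ∧ does (M ∣? k)) (t * M) ≡ count (avoids t M) t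
  count-avoiding-multiples {M} pM t = begin
      count (λ k → avoids (t * M) M k ∧ does (M ∣? k)) (t * M)
    ≡⟨ count-multiples (avoids (t * M) M) M t {{prime⇒nonZero pM}} ⟩
      count (λ j → avoids (t * M) M (j * M)) t
    ≡⟨ count-ext _ _ t (λ j _ _ → avoids-mulʳ pM M ≤-refl (t * M) j) ⟩
      count (avoids (t * M) M) t
    ≡⟨ count-ext _ _ t (λ k _ _ → avoids-mulˡ pM M ≤-refl t k) ⟩
      count (avoids t M) t ∎
    where open ≡-Reasoning

  sieve-step-arith : ∀ X Y Z A B t d → .{{NonZero d}} →
                     X + Y ≡ Z → Z * A ≡ (t * d) * B → Y * A ≡ t * B →
                     X * (A * d) ≡ (t * d) * (B * pred d)
  sieve-step-arith X Y Z A B t (suc r) X+Y≡Z ZA YA = begin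
      X * (A * suc r)     ≡⟨ *-assoc X A (suc r) ⟨
      X * A * suc r       ≡⟨ cong (_* suc r) XA ⟩
      t * r * B * suc r   ≡⟨ regroup t r B ⟩
      t * suc r * (B * r) ∎
    where
    open ≡-Reasoning
    expand : ∀ t r B → t * suc r * B ≡ t * r * B + t * B
    expand = solve-∀
    regroup : ∀ t r B → t * r * B * suc r ≡ t * suc r * (B * r)
    regroup = solve-∀
    XA : X * A ≡ t * r * B
    XA = +-cancelʳ-≡ (t * B) (X * A) (t * r * B) (begin
        X * A + t * B ≡⟨ cong (X * A +_) YA ⟨
        X * A + Y * A ≡⟨ *-distribʳ-+ A X Y ⟨
        (X + Y) * A   ≡⟨ cong (_* A) X+Y≡Z ⟩
        Z * A         ≡⟨ ZA ⟩
        t * suc r * B ≡⟨ expand t r B ⟩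
        t * r * B + t * B ∎)

  sieve : ∀ M n → count (avoids n M) n * prod (primeDivisor n) id M ≡ n * prod (primeDivisor n) pred M
  sieve zero    n = cong (_* 1) (count-true n)
  sieve (suc M) n with primeDivisor n M in eq
  ... | false = begin
      count (λ k → avoids n M k ∧ true) n * (A * 1) ≡⟨ cong (_* (A * 1)) (count-ext _ _ n (λ k _ _ → ∧-identityʳ _)) ⟩
      count (avoids n M) n * (A * 1)       ≡⟨ *-assoc (count (avoids n M) n) A 1 ⟨
      count (avoids n M) n * A * 1         ≡⟨ cong (_* 1) (sieve M n) ⟩
      n * B * 1                            ≡⟨ *-assoc n B 1 ⟩
      n * (B * 1)                          ∎
    where
    open ≡-Reasoning
    A B : ℕ
    A = prod (primeDivisor n) id M
    B = prod (primeDivisor n) pred M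
  ... | true with primeDivisor-sound n M eq
  ...   | pM , divides t refl = sieve-step-arith X Y Z A B t M {{prime⇒nonZero pM}} X+Y≡Z (sieve M n) YA
    where
    open ≡-Reasoning
    A B X Y Z : ℕ
    A = prod (primeDivisor n) id M
    B = prod (primeDivisor n) pred M
    X = count (λ k → avoids n M k ∧ not (does (M ∣? k))) n
    Y = count (avoids t M) t
    Z = count (avoids n M) n
    X+Y≡Z : X + Y ≡ Z
    X+Y≡Z = begin
        X + Y
      ≡⟨ cong (X +_) (count-avoiding-multiples pM t) ⟨
        X + count (λ k → avoids n M k ∧ does (M ∣? k)) n
      ≡⟨ count-split (avoids n M) (λ k → does (M ∣? k)) n ⟨
        Z ∎
    below-M : ∀ f → prod (primeDivisor t) f M ≡ prod (primeDivisor n) f M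
    below-M f = prod-ext _ _ f M (λ p p<M → sym (primeDivisor-mul pM t p p<M))
    YA : Y * A ≡ t * B
    YA = begin
        Y * A                           ≡⟨ cong (Y *_) (below-M id) ⟨
        Y * prod (primeDivisor t) id M  ≡⟨ sieve M t ⟩
        t * prod (primeDivisor t) pred M ≡⟨ cong (t *_) (below-M pred) ⟩
        t * B ∎

  avoids-true : ∀ n M k → (∀ p → p < M → Prime p → p ∣ n → ¬ p ∣ k) → avoids n M k ≡ true
  avoids-true n zero    k h = refl
  avoids-true n (suc M) k h rewrite avoids-true n M k (λ p p<M → h p (m<n⇒m<1+n p<M)) =
    cong not (last (prime? M) (M ∣? n) (M ∣? k) (h M ≤-refl))
    where
    last : (a : Dec (Prime M)) (b : Dec (M ∣ n)) (c : Dec (M ∣ k)) →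
           (Prime M → M ∣ n → ¬ M ∣ k) → (does a ∧ does b) ∧ does c ≡ false
    last (yes pM) (yes M∣n) (yes M∣k) h = contradiction M∣k (h pM M∣n)
    last (yes _)  (yes _)   (no _)    _ = refl
    last (yes _)  (no _)    _         _ = refl
    last (no _)   _         _         _ = refl

  avoids-false : ∀ n M k p → p < M → Prime p → p ∣ n → p ∣ k → avoids n M k ≡ false
  avoids-false n (suc M) k p p<1+M pp p∣n p∣k with m<1+n⇒m<n∨m≡n p<1+M
  ... | inj₁ p<M  rewrite avoids-false n M k p p<M pp p∣n p∣k = refl
  ... | inj₂ refl rewrite dec-true (prime? p) pp | dec-true (p ∣? n) p∣n | dec-true (p ∣? k) p∣k =
    ∧-zeroʳ _

  ≢0∧≢1⇒≥2 : ∀ {g} → g ≢ 0 → g ≢ 1 → 2 ≤ g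
  ≢0∧≢1⇒≥2 {0}           g≢0 _   = contradiction refl g≢0
  ≢0∧≢1⇒≥2 {1}           _   g≢1 = contradiction refl g≢1
  ≢0∧≢1⇒≥2 {suc (suc _)} _   _   = s≤s (s≤s z≤n)

  coprime⇔avoids : ∀ n k → 1 ≤ n → does (gcd k n ≟ 1) ≡ avoids n (suc n) k
  coprime⇔avoids n k 1≤n = decide (gcd k n ≟ 1)
    where
    decide : (d : Dec (gcd k n ≡ 1)) → does d ≡ avoids n (suc n) k
    decide (yes gcd≡1) = sym (avoids-true n (suc n) k λ p _ pp p∣n p∣k →
      ¬prime[1] (subst Prime (∣1⇒≡1 (subst (p ∣_) gcd≡1 (gcd-greatest p∣k p∣n))) pp))
    decide (no gcd≢1) with prime-factor (gcd k n) (≢0∧≢1⇒≥2 gcd≢0 gcd≢1)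
      where
      gcd≢0 : gcd k n ≢ 0
      gcd≢0 = gcd[m,n]≢0 k n (inj₂ λ n≡0 → <⇒≢ 1≤n (sym n≡0))
    ... | p , pp , p∣gcd =
      sym (avoids-false n (suc n) k p (s≤s (∣⇒≤ {{>-nonZero 1≤n}} p∣n)) pp p∣n (∣-trans p∣gcd (gcd[m,n]∣m k n)))
      where
      p∣n : p ∣ n
      p∣n = ∣-trans p∣gcd (gcd[m,n]∣n k n)

  φ-product-formula : ∀ n → 1 ≤ n →
    φ n * prod (primeDivisor n) id (suc n) ≡ n * prod (primeDivisor n) pred (suc n)
  φ-product-formula n 1≤n = begin
      φ n * prod (primeDivisor n) id (suc n)
    ≡⟨ cong (_* prod (primeDivisor n) id (suc n))
            (trans (φ≡count n) (count-ext _ _ n (λ k _ _ → coprime⇔avoids n k 1≤n))) ⟩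
      count (avoids n (suc n)) n * prod (primeDivisor n) id (suc n)
    ≡⟨ sieve (suc n) n ⟩
      n * prod (primeDivisor n) pred (suc n) ∎
    where open ≡-Reasoning

-- The truncated Euler product
--   E(M) = ∏_{p < M, p < 7} p/(p − 1) · ∏_{7 ≤ p < M} p²/(p² − 1)   (p prime)
-- is below 99/25 for every M.  Up to M = 300 this is a finite computation;
-- beyond it, p²/(p² − 1) = (p/(p − 1))·(p/(p + 1)) telescopes:
-- E(M)·M/(M − 1) is non-increasing in M.
module EulerProductBound where

  open Counting
  open import Data.Nat
  open import Data.Nat.Properties
  open import Data.Nat.Primality using (prime?)
  open import Data.Nat.Tactic.RingSolver using (solve-∀)
  open import Data.Bool using (Bool; true; false; if_then_else_)
  open import Data.Unit using (tt)
  open import Relation.Nullary using (yes; no; does)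
  open import Relation.Nullary.Decidable using (dec-true)
  open import Relation.Binary.PropositionalEquality

  isPrime : ℕ → Bool
  isPrime p = does (prime? p)

  eulerNum eulerDen : ℕ → ℕ
  eulerNum p = if does (7 ≤? p) then p * p else p
  eulerDen p = if does (7 ≤? p) then pred p * suc p else pred p

  pred*suc<square : ∀ r → r * suc (suc r) < suc r * suc r
  pred*suc<square r = ≤-reflexive (e r)
    where
    e : ∀ r → suc (r * suc (suc r)) ≡ suc r * suc r
    e = solve-∀

  eulerDen≤eulerNum : ∀ p → eulerDen p ≤ eulerNum p
  eulerDen≤eulerNum p with does (7 ≤? p)
  eulerDen≤eulerNum zero    | true = z≤n
  eulerDen≤eulerNum (suc r) | true = <⇒≤ (pred*suc<square r)
  ... | false = pred[n]≤n

  eulerDen-pos : ∀ p → isPrime p ≡ true → 1 ≤ eulerDen p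
  eulerDen-pos 0 ()
  eulerDen-pos 1 ()
  eulerDen-pos (suc (suc r)) _ with does (7 ≤? suc (suc r))
  ... | true  = s≤s z≤n
  ... | false = s≤s z≤n

  numE denE : ℕ → ℕ
  numE = prod isPrime eulerNum
  denE = prod isPrime eulerDen

  denE-pos : ∀ M → 1 ≤ denE M
  denE-pos M = prod-pos isPrime eulerDen M eulerDen-pos

  abstract
    C : ℕ
    C = 300

    7≤C : 7 ≤ C
    7≤C = ≤ᵇ⇒≤ 7 300 tt

    bound-at-C : numE C * 25 * C ≤ 99 * pred C * denE C
    bound-at-C = ≤ᵇ⇒≤ _ _ tt

  -- One step of the telescoping invariant a·25·M ≤ 99·(M − 1)·b, for M ≥ 7:
  -- a prime M contributes M²/((M − 1)(M + 1)), and M/(M − 1) ≥ (M + 1)/M.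
  telescope-step : ∀ a b M → 7 ≤ M → a * 25 * M ≤ 99 * pred M * b → (u : Bool) →
    a * (if u then M * M else 1) * 25 * suc M ≤ 99 * M * (b * (if u then pred M * suc M else 1))
  telescope-step a b (suc r) _ inv true = begin
      a * (suc r * suc r) * 25 * suc (suc r) ≡⟨ regroup₁ a r ⟩
      a * 25 * suc r * (suc r * suc (suc r)) ≤⟨ *-monoˡ-≤ (suc r * suc (suc r)) inv ⟩
      99 * r * b * (suc r * suc (suc r))     ≡⟨ regroup₂ r b ⟩
      99 * suc r * (b * (r * suc (suc r)))   ∎
    where
    open ≤-Reasoning
    regroup₁ : ∀ a r → a * (suc r * suc r) * 25 * suc (suc r) ≡ a * 25 * suc r * (suc r * suc (suc r))
    regroup₁ = solve-∀
    regroup₂ : ∀ r b → 99 * r * b * (suc r * suc (suc r)) ≡ 99 * suc r * (b * (r * suc (suc r)))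
    regroup₂ = solve-∀
  telescope-step a b (suc r) _ inv false = *-cancelʳ-≤ _ _ (suc r) (begin
      a * 1 * 25 * suc (suc r) * suc r ≡⟨ regroup₁ a r ⟩
      a * 25 * suc r * suc (suc r)     ≤⟨ *-monoˡ-≤ (suc (suc r)) inv ⟩
      99 * r * b * suc (suc r)         ≡⟨ regroup₂ r b ⟩
      99 * b * (r * suc (suc r))       ≤⟨ *-monoʳ-≤ (99 * b) (<⇒≤ (pred*suc<square r)) ⟩
      99 * b * (suc r * suc r)         ≡⟨ regroup₃ r b ⟩
      99 * suc r * (b * 1) * suc r     ∎)
    where
    open ≤-Reasoning
    regroup₁ : ∀ a r → a * 1 * 25 * suc (suc r) * suc r ≡ a * 25 * suc r * suc (suc r)
    regroup₁ = solve-∀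
    regroup₂ : ∀ r b → 99 * r * b * suc (suc r) ≡ 99 * b * (r * suc (suc r))
    regroup₂ = solve-∀
    regroup₃ : ∀ r b → 99 * b * (suc r * suc r) ≡ 99 * suc r * (b * 1) * suc r
    regroup₃ = solve-∀

  eulerNum-large : ∀ M → 7 ≤ M → eulerNum M ≡ M * M
  eulerNum-large M 7≤M rewrite dec-true (7 ≤? M) 7≤M = refl

  eulerDen-large : ∀ M → 7 ≤ M → eulerDen M ≡ pred M * suc M
  eulerDen-large M 7≤M rewrite dec-true (7 ≤? M) 7≤M = refl

  bound-beyond-C : ∀ k → numE (C + k) * 25 * (C + k) ≤ 99 * pred (C + k) * denE (C + k)
  bound-beyond-C zero    = subst (λ M → numE M * 25 * M ≤ 99 * pred M * denE M) (sym (+-identityʳ C)) bound-at-C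
  bound-beyond-C (suc k) rewrite +-suc C k =
    subst₂ (λ u v → numE M * (if isPrime M then u else 1) * 25 * suc M
                      ≤ 99 * M * (denE M * (if isPrime M then v else 1)))
           (sym (eulerNum-large M 7≤M)) (sym (eulerDen-large M 7≤M))
           (telescope-step (numE M) (denE M) M 7≤M (bound-beyond-C k) (isPrime M))
    where
    M : ℕ
    M = C + k
    7≤M : 7 ≤ M
    7≤M = ≤-trans 7≤C (m≤m+n C k)

  drop-telescope : ∀ a b M → 1 ≤ M → a * 25 * M ≤ 99 * pred M * b → a * 25 ≤ 99 * b
  drop-telescope a b M@(suc _) _ inv = *-cancelʳ-≤ _ _ M (begin
      a * 25 * M       ≤⟨ inv ⟩
      99 * pred M * b  ≤⟨ *-monoˡ-≤ b (*-monoʳ-≤ 99 (n≤1+n (pred M))) ⟩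
      99 * M * b       ≡⟨ swap 99 M b ⟩
      99 * b * M       ∎)
    where
    open ≤-Reasoning
    swap : ∀ a b c → a * b * c ≡ a * c * b
    swap = solve-∀

  euler-bound : ∀ M → numE M * 25 ≤ 99 * denE M
  euler-bound M with M ≤? C
  ... | no M≰C = drop-telescope (numE M) (denE M) M (≤-trans (≤-trans (s≤s z≤n) 7≤C) C≤M)
                   (subst (λ K → numE K * 25 * K ≤ 99 * pred K * denE K) (m+[n∸m]≡n C≤M) (bound-beyond-C (M ∸ C)))
    where
    C≤M : C ≤ M
    C≤M = ≰⇒≥ M≰C
  ... | yes M≤C = *-cancelʳ-≤ _ _ (denE C) {{>-nonZero (denE-pos C)}} (begin
      numE M * 25 * denE C   ≡⟨ regroup₁ (numE M) (denE C) ⟩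
      numE M * denE C * 25   ≤⟨ *-monoˡ-≤ 25 E[M]≤E[C] ⟩
      numE C * denE M * 25   ≡⟨ regroup₂ (numE C) (denE M) ⟩
      denE M * (numE C * 25) ≤⟨ *-monoʳ-≤ (denE M) E[C]≤ ⟩
      denE M * (99 * denE C) ≡⟨ regroup₃ (denE M) (denE C) ⟩
      99 * denE M * denE C   ∎)
    where
    open ≤-Reasoning
    E[M]≤E[C] : numE M * denE C ≤ numE C * denE M
    E[M]≤E[C] = subst (λ K → numE M * denE K ≤ numE K * denE M) (m+[n∸m]≡n M≤C)
                  (prod-ratio-mono isPrime eulerNum eulerDen M (C ∸ M) (λ p _ → eulerDen≤eulerNum p))
    E[C]≤ : numE C * 25 ≤ 99 * denE C
    E[C]≤ = drop-telescope (numE C) (denE C) C (≤-trans (s≤s z≤n) 7≤C) bound-at-C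
    regroup₁ : ∀ a b → a * 25 * b ≡ a * b * 25
    regroup₁ = solve-∀
    regroup₂ : ∀ a b → a * b * 25 ≡ b * (a * 25)
    regroup₂ = solve-∀
    regroup₃ : ∀ a b → a * (99 * b) ≡ 99 * a * b
    regroup₃ = solve-∀

-- If x·φ(N) ≤ N, then x ≤ N/φ(N) = ∏_{p ∣ N} p/(p − 1)
--   = ∏_{p ∣ N} (Euler factor at p) · ∏_{p ∣ N, p ≥ 7} (p + 1)/p
--   ≤ (99/25) · ∏_{p ∣ N, p ≥ 7} (1 + 1/p).
module AbundancyBound where

  open Counting
  open ProductFormula
  open EulerProductBound
  open import Defs using (φ)
  open import Data.Nat
  open import Data.Nat.Properties
  open import Data.Nat.Divisibility using (_∣?_)
  open import Data.Nat.Primality using (prime?)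
  open import Data.Nat.Tactic.RingSolver using (solve-∀)
  open import Data.Bool using (Bool; true; false; _∧_; if_then_else_)
  open import Data.Product using (proj₁)
  open import Relation.Nullary using (does)
  open import Relation.Binary.PropositionalEquality
  open import Function using (id)

  largePrimeDivisor : ℕ → ℕ → Bool
  largePrimeDivisor N p = does (prime? p) ∧ (does (7 ≤? p) ∧ does (p ∣? N))

  largePrimeDivisor-reassoc : ∀ N p → primeDivisor N p ∧ does (7 ≤? p) ≡ largePrimeDivisor N p
  largePrimeDivisor-reassoc N p with does (prime? p) | does (7 ≤? p) | does (p ∣? N)
  ... | true  | true  | true  = refl
  ... | true  | true  | false = refl
  ... | true  | false | true  = refl
  ... | true  | false | false = refl
  ... | false | _     | _     = refl

  split-factors : ∀ N (f g : ℕ → ℕ) M →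
    prod (primeDivisor N) (λ p → if does (7 ≤? p) then f p * g p else f p) M
      ≡ prod (primeDivisor N) f M * prod (largePrimeDivisor N) g M
  split-factors N f g M =
    trans (prod-split (primeDivisor N) (λ p → does (7 ≤? p)) f g M)
          (cong (prod (primeDivisor N) f M *_) (prod-ext _ _ g M (λ p _ → largePrimeDivisor-reassoc N p)))

  primeDivisor⇒isPrime : ∀ N p → primeDivisor N p ≡ true → isPrime p ≡ true
  primeDivisor⇒isPrime N p with does (prime? p)
  ... | true = λ _ → refl

  abundancy-bound : ∀ N x → 1 ≤ N → x * φ N ≤ N →
    x * 25 * prod (largePrimeDivisor N) id (suc N) ≤ 99 * prod (largePrimeDivisor N) suc (suc N)
  abundancy-bound N x 1≤N xφ≤N = *-cancelˡ-≤ (A * β) {{>-nonZero (*-mono-≤ A-pos (denE-pos M))}} (begin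
      A * β * (x * 25 * L)   ≡⟨ regroup₁ A β x L ⟩
      x * 25 * (A * L * β)   ≤⟨ *-monoʳ-≤ (x * 25) divisors≤all-primes ⟩
      x * 25 * (α * (B * D)) ≡⟨ regroup₂ x α B D ⟩
      α * 25 * (x * B) * D   ≤⟨ *-monoˡ-≤ D (*-mono-≤ (euler-bound M) xB≤A) ⟩
      99 * β * A * D         ≡⟨ regroup₃ β A D ⟩
      A * β * (99 * D)       ∎)
    where
    open ≤-Reasoning
    M A B L D α β : ℕ
    M = suc N
    A = prod (primeDivisor N) id M
    B = prod (primeDivisor N) pred M
    L = prod (largePrimeDivisor N) id M
    D = prod (largePrimeDivisor N) suc M
    α = numE M
    β = denE M
    A-pos : 1 ≤ A
    A-pos = prod-pos (primeDivisor N) id M λ p e → <⇒≤ (prime⇒≥2 (proj₁ (primeDivisor-sound N p e)))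
    regroup₄ : ∀ N x B → N * (x * B) ≡ x * (N * B)
    regroup₄ = solve-∀
    xB≤A : x * B ≤ A
    xB≤A = *-cancelˡ-≤ N {{>-nonZero 1≤N}} (begin
        N * (x * B)   ≡⟨ regroup₄ N x B ⟩
        x * (N * B)   ≡⟨ cong (x *_) (φ-product-formula N 1≤N) ⟨
        x * (φ N * A) ≡⟨ *-assoc x (φ N) A ⟨
        x * φ N * A   ≤⟨ *-monoˡ-≤ A xφ≤N ⟩
        N * A         ∎)
    -- ∏_{p ∣ N} (Euler factor) ≤ ∏_{p prime} (Euler factor) = E(M)
    divisors≤all-primes : A * L * β ≤ α * (B * D)
    divisors≤all-primes =
      subst₂ (λ u v → u * β ≤ α * v) (split-factors N id id M) (split-factors N pred suc M)
        (prod-ratio-subset (primeDivisor N) isPrime eulerNum eulerDen M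
           (primeDivisor⇒isPrime N) (λ p _ → eulerDen≤eulerNum p))
    regroup₁ : ∀ A β x L → A * β * (x * 25 * L) ≡ x * 25 * (A * L * β)
    regroup₁ = solve-∀
    regroup₂ : ∀ x α B D → x * 25 * (α * (B * D)) ≡ α * 25 * (x * B) * D
    regroup₂ = solve-∀
    regroup₃ : ∀ β A D → 99 * β * A * D ≡ A * β * (99 * D)
    regroup₃ = solve-∀

-- The key inequality is
--   expPartial c K · (1 + a) ≤ expPartial (c + a) (K + 1)      (c, a ≥ 0),
-- a finite form of exp(c)·(1 + a) ≤ exp(c + a); iterating it over the
-- primes p of a list gives exp(c)·∏(1 + 1/p) ≤ exp(c + Σ 1/p).
module ExponentialBound where

  open Counting using (listProd)
  open import Defs using (inv; expTerm; expPartial; LogLt; c138)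
  open import Data.Nat as ℕ using (ℕ; zero; suc)
  import Data.Nat.Properties as ℕ
  open import Data.Nat.Coprimality using (1-coprimeTo) renaming (sym to coprime-sym)
  open import Data.Integer using (+_; +≤+; +<+)
  import Data.Integer as ℤ
  import Data.Integer.Properties as ℤ
  open import Data.Rational
  open import Data.Rational.Properties
  open import Data.Rational.Solver using (module +-*-Solver)
  open +-*-Solver using (solve; _:+_; _:*_; _:=_; con)
  open import Data.List using (List; []; _∷_; foldr; length)
  open import Data.List.Relation.Unary.All using (All; []; _∷_)
  open import Data.Product using (_,_)
  open import Data.Unit using (tt)
  open import Relation.Binary.PropositionalEquality
  open import Relation.Nullary.Decidable using (toWitness)
  open import Function using (id)

  ι : ℕ → ℚ
  ι n = + n / 1

  ι-normal : ∀ n → ι n ≡ mkℚ (+ n) 0 (coprime-sym (1-coprimeTo n))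
  ι-normal n = normalize-coprime (coprime-sym (1-coprimeTo n))

  ι-* : ∀ a b → ι a * ι b ≡ ι (a ℕ.* b)
  ι-* a b rewrite ι-normal a | ι-normal b = cong (_/ 1) (sym (ℤ.pos-* a b))

  ι-+ : ∀ a b → ι a + ι b ≡ ι (a ℕ.+ b)
  ι-+ a b rewrite ι-normal a | ι-normal b =
    cong (_/ 1) (trans (cong₂ ℤ._+_ (ℤ.*-identityʳ (+ a)) (ℤ.*-identityʳ (+ b))) (sym (ℤ.pos-+ a b)))

  ι-≤ : ∀ {a b} → a ℕ.≤ b → ι a ≤ ι b
  ι-≤ {a} {b} a≤b rewrite ι-normal a | ι-normal b =
    *≤* (subst₂ ℤ._≤_ (sym (ℤ.*-identityʳ (+ a))) (sym (ℤ.*-identityʳ (+ b))) (+≤+ a≤b))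

  ι-< : ∀ {a b} → a ℕ.< b → ι a < ι b
  ι-< {a} {b} a<b rewrite ι-normal a | ι-normal b =
    *<* (subst₂ ℤ._<_ (sym (ℤ.*-identityʳ (+ a))) (sym (ℤ.*-identityʳ (+ b))) (+<+ a<b))

  inv*ι : ∀ k → inv (suc k) * ι (suc k) ≡ 1ℚ
  inv*ι k rewrite normalize-coprime (1-coprimeTo (suc k)) | ι-normal (suc k) =
    *-inverseˡ (mkℚ (+ suc k) 0 (coprime-sym (1-coprimeTo (suc k))))

  *-monoʳ-≤-0≤ : ∀ {p q} r → 0ℚ ≤ r → p ≤ q → p * r ≤ q * r
  *-monoʳ-≤-0≤ r 0≤r p≤q = *-monoʳ-≤-nonNeg r {{nonNegative 0≤r}} p≤q

  0≤* : ∀ {p q} → 0ℚ ≤ p → 0ℚ ≤ q → 0ℚ ≤ p * q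
  0≤* {p} {q} 0≤p 0≤q = subst (_≤ p * q) (*-zeroˡ q) (*-monoʳ-≤-0≤ q 0≤q 0≤p)

  0≤+ : ∀ {p q} → 0ℚ ≤ p → 0ℚ ≤ q → 0ℚ ≤ p + q
  0≤+ {p} {q} 0≤p 0≤q = subst (_≤ p + q) (+-identityˡ 0ℚ) (+-mono-≤ 0≤p 0≤q)

  ≤+0≤ : ∀ p {q} → 0ℚ ≤ q → p ≤ p + q
  ≤+0≤ p {q} 0≤q = subst (_≤ p + q) (+-identityʳ p) (+-monoʳ-≤ p 0≤q)

  0≤1 : 0ℚ ≤ 1ℚ
  0≤1 = ι-≤ {0} {1} ℕ.z≤n

  0≤inv : ∀ k → 0ℚ ≤ inv k
  0≤inv zero    = ≤-refl
  0≤inv (suc k) = nonNegative⁻¹ _ {{normalize-nonNeg 1 (suc k)}}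

  0≤expTerm : ∀ {c} → 0ℚ ≤ c → ∀ k → 0ℚ ≤ expTerm c k
  0≤expTerm 0≤c zero    = 0≤1
  0≤expTerm 0≤c (suc k) = 0≤* (0≤* (0≤expTerm 0≤c k) 0≤c) (0≤inv (suc k))

  expTerm-rec : ∀ c k → expTerm c k * c ≡ expTerm c (suc k) * ι (suc k)
  expTerm-rec c k = begin
      expTerm c k * c                             ≡⟨ *-identityʳ _ ⟨
      expTerm c k * c * 1ℚ                        ≡⟨ cong (expTerm c k * c *_) (inv*ι k) ⟨
      expTerm c k * c * (inv (suc k) * ι (suc k)) ≡⟨ *-assoc (expTerm c k * c) _ _ ⟨
      expTerm c (suc k) * ι (suc k)               ∎
    where open ≡-Reasoning

  -- The first two binomial terms of (c + a)^{k+1}/(k+1)!: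
  --   c^{k+1}/(k+1)! + a · c^k/k! ≤ (c + a)^{k+1}/(k+1)!.
  expTerm-binomial : ∀ {c a} → 0ℚ ≤ c → 0ℚ ≤ a → ∀ k →
                     expTerm c (suc k) + a * expTerm c k ≤ expTerm (c + a) (suc k)
  expTerm-binomial {c} {a} _ _ zero =
    ≤-reflexive (solve 2 (λ c a → con 1ℚ :* c :* con 1ℚ :+ a :* con 1ℚ := con 1ℚ :* (c :+ a) :* con 1ℚ) refl c a)
  expTerm-binomial {c} {a} 0≤c 0≤a (suc k) = begin
      t₁ * c * i + a * t₁                   ≤⟨ ≤+0≤ _ (0≤* (0≤* (0≤* 0≤a 0≤a) (0≤expTerm 0≤c k)) (0≤inv (suc (suc k)))) ⟩
      t₁ * c * i + a * t₁ + a * a * t₀ * i  ≡⟨ expand ⟨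
      (t₁ + a * t₀) * (c + a) * i           ≤⟨ *-monoʳ-≤-0≤ i (0≤inv (suc (suc k)))
                                                 (*-monoʳ-≤-0≤ (c + a) (0≤+ 0≤c 0≤a) (expTerm-binomial 0≤c 0≤a k)) ⟩
      expTerm (c + a) (suc k) * (c + a) * i ∎
    where
    open ≤-Reasoning
    t₁ t₀ i j : ℚ
    t₁ = expTerm c (suc k)
    t₀ = expTerm c k
    i = inv (suc (suc k))
    j = ι (suc k)
    expand : (t₁ + a * t₀) * (c + a) * i ≡ t₁ * c * i + a * t₁ + a * a * t₀ * i
    expand = begin-equality
        (t₁ + a * t₀) * (c + a) * i
      ≡⟨ solve 5 (λ t₁ t₀ c a i → (t₁ :+ a :* t₀) :* (c :+ a) :* i
                   := t₁ :* c :* i :+ a :* t₁ :* i :+ a :* (t₀ :* c) :* i :+ a :* a :* t₀ :* i) refl t₁ t₀ c a i ⟩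
        t₁ * c * i + a * t₁ * i + a * (t₀ * c) * i + a * a * t₀ * i
      ≡⟨ cong (λ v → t₁ * c * i + a * t₁ * i + a * v * i + a * a * t₀ * i) (expTerm-rec c k) ⟩
        t₁ * c * i + a * t₁ * i + a * (t₁ * j) * i + a * a * t₀ * i
      ≡⟨ solve 6 (λ t₁ t₀ c a i j → t₁ :* c :* i :+ a :* t₁ :* i :+ a :* (t₁ :* j) :* i :+ a :* a :* t₀ :* i
                   := t₁ :* c :* i :+ a :* t₁ :* (i :* (con 1ℚ :+ j)) :+ a :* a :* t₀ :* i) refl t₁ t₀ c a i j ⟩
        t₁ * c * i + a * t₁ * (i * (1ℚ + j)) + a * a * t₀ * i
      ≡⟨ cong (λ v → t₁ * c * i + a * t₁ * (i * v) + a * a * t₀ * i) (ι-+ 1 (suc k)) ⟩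
        t₁ * c * i + a * t₁ * (i * ι (suc (suc k))) + a * a * t₀ * i
      ≡⟨ cong (λ v → t₁ * c * i + a * t₁ * v + a * a * t₀ * i) (inv*ι (suc k)) ⟩
        t₁ * c * i + a * t₁ * 1ℚ + a * a * t₀ * i
      ≡⟨ cong (λ v → t₁ * c * i + v + a * a * t₀ * i) (*-identityʳ (a * t₁)) ⟩
        t₁ * c * i + a * t₁ + a * a * t₀ * i ∎

  expPartial-binomial : ∀ {c a} → 0ℚ ≤ c → 0ℚ ≤ a → ∀ K →
                        expPartial c (suc K) + a * expPartial c K ≤ expPartial (c + a) (suc K)
  expPartial-binomial {c} {a} _ _ zero =
    ≤-reflexive (solve 1 (λ a → con 0ℚ :+ con 1ℚ :+ a :* con 0ℚ := con 0ℚ :+ con 1ℚ) refl a)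
  expPartial-binomial {c} {a} 0≤c 0≤a (suc K) = begin
      expPartial c (suc K) + expTerm c (suc K) + a * (expPartial c K + expTerm c K)
    ≡⟨ solve 5 (λ e₁ t₁ a e₀ t₀ → e₁ :+ t₁ :+ a :* (e₀ :+ t₀) := (e₁ :+ a :* e₀) :+ (t₁ :+ a :* t₀)) refl
         (expPartial c (suc K)) (expTerm c (suc K)) a (expPartial c K) (expTerm c K) ⟩
      (expPartial c (suc K) + a * expPartial c K) + (expTerm c (suc K) + a * expTerm c K)
    ≤⟨ +-mono-≤ (expPartial-binomial 0≤c 0≤a K) (expTerm-binomial 0≤c 0≤a K) ⟩
      expPartial (c + a) (suc (suc K)) ∎
    where open ≤-Reasoning

  expPartial-mul : ∀ {c a} → 0ℚ ≤ c → 0ℚ ≤ a → ∀ K → expPartial c K * (1ℚ + a) ≤ expPartial (c + a) (suc K)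
  expPartial-mul {c} {a} 0≤c 0≤a K = begin
      expPartial c K * (1ℚ + a)
    ≡⟨ solve 2 (λ e a → e :* (con 1ℚ :+ a) := e :+ a :* e) refl (expPartial c K) a ⟩
      expPartial c K + a * expPartial c K
    ≤⟨ +-monoˡ-≤ (a * expPartial c K) (≤+0≤ (expPartial c K) (0≤expTerm 0≤c K)) ⟩
      expPartial c (suc K) + a * expPartial c K
    ≤⟨ expPartial-binomial 0≤c 0≤a K ⟩
      expPartial (c + a) (suc K) ∎
    where open ≤-Reasoning

  sumInv : List ℕ → ℚ
  sumInv = foldr (λ p s → inv p + s) 0ℚ

  prodInv : List ℕ → ℚ
  prodInv = foldr (λ p q → (1ℚ + inv p) * q) 1ℚ

  0≤sumInv : ∀ L → 0ℚ ≤ sumInv L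
  0≤sumInv []      = ≤-refl
  0≤sumInv (p ∷ L) = 0≤+ (0≤inv p) (0≤sumInv L)

  1≤prodInv : ∀ L → 1ℚ ≤ prodInv L
  1≤prodInv []      = ≤-refl
  1≤prodInv (p ∷ L) = begin
      1ℚ                       ≤⟨ 1≤prodInv L ⟩
      prodInv L                ≡⟨ *-identityˡ (prodInv L) ⟨
      1ℚ * prodInv L           ≤⟨ *-monoʳ-≤-0≤ (prodInv L) (≤-trans 0≤1 (1≤prodInv L)) (≤+0≤ 1ℚ (0≤inv p)) ⟩
      (1ℚ + inv p) * prodInv L ∎
    where open ≤-Reasoning

  prodInv-integral : ∀ L → All (1 ℕ.≤_) L → prodInv L * ι (listProd id L) ≡ ι (listProd suc L)
  prodInv-integral []      []         = refl
  prodInv-integral (p ∷ L) (1≤p ∷ 1≤L) = begin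
      (1ℚ + inv p) * prodInv L * ι (p ℕ.* listProd id L)
    ≡⟨ cong ((1ℚ + inv p) * prodInv L *_) (sym (ι-* p (listProd id L))) ⟩
      (1ℚ + inv p) * prodInv L * (ι p * ι (listProd id L))
    ≡⟨ solve 4 (λ i q a b → (con 1ℚ :+ i) :* q :* (a :* b) := (a :+ i :* a) :* (q :* b)) refl
         (inv p) (prodInv L) (ι p) (ι (listProd id L)) ⟩
      (ι p + inv p * ι p) * (prodInv L * ι (listProd id L))
    ≡⟨ cong₂ _*_ (succ p 1≤p) (prodInv-integral L 1≤L) ⟩
      ι (suc p) * ι (listProd suc L)
    ≡⟨ ι-* (suc p) (listProd suc L) ⟩
      ι (suc p ℕ.* listProd suc L) ∎
    where
    open ≡-Reasoning
    succ : ∀ p → 1 ℕ.≤ p → ι p + inv p * ι p ≡ ι (suc p)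
    succ (suc k) _ = trans (cong (λ v → ι (suc k) + v) (inv*ι k)) (trans (ι-+ (suc k) 1) (cong ι (ℕ.+-comm (suc k) 1)))

  expPartial-prodInv : ∀ {c} → 0ℚ ≤ c → ∀ L K →
                       expPartial c K * prodInv L ≤ expPartial (c + sumInv L) (K ℕ.+ length L)
  expPartial-prodInv {c} _ [] K =
    ≤-reflexive (trans (*-identityʳ _) (cong₂ expPartial (sym (+-identityʳ c)) (sym (ℕ.+-identityʳ K))))
  expPartial-prodInv {c} 0≤c (p ∷ L) K = begin
      expPartial c K * ((1ℚ + inv p) * prodInv L)
    ≡⟨ solve 3 (λ e i q → e :* ((con 1ℚ :+ i) :* q) := e :* q :* (con 1ℚ :+ i)) refl
         (expPartial c K) (inv p) (prodInv L) ⟩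
      expPartial c K * prodInv L * (1ℚ + inv p)
    ≤⟨ *-monoʳ-≤-0≤ (1ℚ + inv p) (0≤+ 0≤1 (0≤inv p)) (expPartial-prodInv 0≤c L K) ⟩
      expPartial (c + sumInv L) (K ℕ.+ length L) * (1ℚ + inv p)
    ≤⟨ expPartial-mul (0≤+ 0≤c (0≤sumInv L)) (0≤inv p) (K ℕ.+ length L) ⟩
      expPartial (c + sumInv L + inv p) (suc (K ℕ.+ length L))
    ≡⟨ cong₂ expPartial (solve 3 (λ c s i → c :+ s :+ i := c :+ (i :+ s)) refl c (sumInv L) (inv p))
                        (sym (ℕ.+-suc K (length L))) ⟩
      expPartial (c + sumInv (p ∷ L)) (K ℕ.+ length (p ∷ L)) ∎
    where open ≤-Reasoning

  99<25·E₁₄[c138] : ι 99 < expPartial c138 14 * ι 25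
  99<25·E₁₄[c138] = toWitness {a? = ι 99 <? expPartial c138 14 * ι 25} tt

  0≤c138 : 0ℚ ≤ c138
  0≤c138 = toWitness {a? = 0ℚ ≤? c138} tt

  logLt-from-product : ∀ x L → All (1 ℕ.≤_) L →
                       x ℕ.* 25 ℕ.* listProd id L ℕ.≤ 99 ℕ.* listProd suc L → LogLt x (c138 + sumInv L)
  logLt-from-product x L 1≤L x≤ = 14 ℕ.+ length L , <-≤-trans x<E·Q (expPartial-prodInv 0≤c138 L 14)
    where
    open ≤-Reasoning
    P : ℕ
    P = listProd id L
    Q E : ℚ
    Q = prodInv L
    E = expPartial c138 14
    P-pos : 1 ℕ.≤ P
    P-pos = go L 1≤L
      where
      go : ∀ L → All (1 ℕ.≤_) L → 1 ℕ.≤ listProd id L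
      go []      []          = ℕ.≤-refl
      go (p ∷ L) (1≤p ∷ 1≤L) = ℕ.*-mono-≤ 1≤p (go L 1≤L)
    instance
      ιP-pos : Positive (ι P)
      ιP-pos = positive (ι-< {0} {P} P-pos)
      Q-pos : Positive Q
      Q-pos = positive (<-≤-trans (ι-< {0} {1} (ℕ.s≤s ℕ.z≤n)) (1≤prodInv L))
      25-nonNeg : NonNegative (ι 25)
      25-nonNeg = nonNegative (ι-≤ {0} {25} ℕ.z≤n)
    x·25·P≤99·Q·P : ι x * ι 25 * ι P ≤ ι 99 * Q * ι P
    x·25·P≤99·Q·P = begin
        ι x * ι 25 * ι P           ≡⟨ trans (cong (_* ι P) (ι-* x 25)) (ι-* (x ℕ.* 25) P) ⟩
        ι (x ℕ.* 25 ℕ.* P)         ≤⟨ ι-≤ x≤ ⟩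
        ι (99 ℕ.* listProd suc L)  ≡⟨ ι-* 99 (listProd suc L) ⟨
        ι 99 * ι (listProd suc L)  ≡⟨ cong (ι 99 *_) (prodInv-integral L 1≤L) ⟨
        ι 99 * (Q * ι P)           ≡⟨ *-assoc (ι 99) Q (ι P) ⟨
        ι 99 * Q * ι P             ∎
    x·25<E·Q·25 : ι x * ι 25 < E * Q * ι 25
    x·25<E·Q·25 = begin-strict
        ι x * ι 25   ≤⟨ *-cancelʳ-≤-pos (ι P) x·25·P≤99·Q·P ⟩
        ι 99 * Q     <⟨ *-monoˡ-<-pos Q 99<25·E₁₄[c138] ⟩
        E * ι 25 * Q ≡⟨ solve 3 (λ e a q → e :* a :* q := e :* q :* a) refl E (ι 25) Q ⟩
        E * Q * ι 25 ∎
    x<E·Q : ι x < E * Q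
    x<E·Q = *-cancelʳ-<-nonNeg (ι 25) x·25<E·Q·25

-- The totient equation of the theorem forces x·φ(N) ≤ N for
-- N = z·(x^m + y^m)/(x + y), because x·(x^n − y^n) ≤ x^{n+1} ≤ x^m.
module TotientEquation where

  open import Defs using (φ; _div_)
  open import Data.Nat
  open import Data.Nat.Properties
  open import Data.Nat.DivMod hiding (_div_)
  open import Algebra.Properties.CommutativeSemigroup *-commutativeSemigroup using (x∙yz≈y∙xz)
  open import Data.Product using (_×_; _,_)
  open import Relation.Binary.PropositionalEquality

  *-/-≤ : ∀ x a d .{{_ : NonZero d}} → x * (a / d) ≤ (x * a) / d
  *-/-≤ x a d = begin
      x * (a / d)         ≡⟨ m*n/n≡m (x * (a / d)) d ⟨
      x * (a / d) * d / d ≤⟨ /-monoˡ-≤ d (≤-trans (≤-reflexive (*-assoc x (a / d) d)) (*-monoʳ-≤ x (m/n*n≤m a d))) ⟩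
      x * a / d           ∎
    where open ≤-Reasoning

  ≤-^ : ∀ a k → .{{NonZero k}} → a ≤ a ^ k
  ≤-^ zero    k         = z≤n
  ≤-^ (suc a) (suc j) = ≤-trans (≤-reflexive (sym (*-identityʳ (suc a)))) (*-monoʳ-≤ (suc a) (m^n>0 (suc a) j))

  x·[xⁿ−yⁿ]≤xᵐ+yᵐ : ∀ x y m n → .{{NonZero x}} → n < m → x * (x ^ n ∸ y ^ n) ≤ x ^ m + y ^ m
  x·[xⁿ−yⁿ]≤xᵐ+yᵐ x y m n n<m = begin
      x * (x ^ n ∸ y ^ n) ≤⟨ *-monoʳ-≤ x (m∸n≤m (x ^ n) (y ^ n)) ⟩
      x ^ suc n           ≤⟨ ^-monoʳ-≤ x n<m ⟩
      x ^ m               ≤⟨ m≤m+n (x ^ m) (y ^ m) ⟩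
      x ^ m + y ^ m       ∎
    where open ≤-Reasoning

  totient-equation-bound : ∀ x y z m n → y < x → n < m → 1 ≤ z →
    φ (z * ((x ^ m + y ^ m) div (x + y))) ≡ z * ((x ^ n ∸ y ^ n) div (x + y)) →
    x * φ (z * ((x ^ m + y ^ m) div (x + y))) ≤ z * ((x ^ m + y ^ m) div (x + y))
      × 1 ≤ z * ((x ^ m + y ^ m) div (x + y))
  totient-equation-bound x@(suc x′) y z m@(suc _) n y<x n<m 1≤z φ≡ = xφ≤N , N-pos
    where
    open ≤-Reasoning
    d N : ℕ
    d = suc (x′ + y)
    N = z * ((x ^ m + y ^ m) / d)
    xφ≤N : x * φ N ≤ N
    xφ≤N = begin
        x * φ N                          ≡⟨ cong (x *_) φ≡ ⟩
        x * (z * ((x ^ n ∸ y ^ n) / d))  ≡⟨ x∙yz≈y∙xz x z _ ⟩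
        z * (x * ((x ^ n ∸ y ^ n) / d))  ≤⟨ *-monoʳ-≤ z (≤-trans (*-/-≤ x (x ^ n ∸ y ^ n) d) (/-monoˡ-≤ d (x·[xⁿ−yⁿ]≤xᵐ+yᵐ x y m n n<m))) ⟩
        N                                ∎
    N-pos : 1 ≤ N
    N-pos = *-mono-≤ 1≤z (m≥n⇒m/n>0 (+-mono-≤ (≤-^ x m) (≤-^ y m)))

open import Defs
open import Data.Nat using (ℕ; _+_; _*_; _∸_; _^_; _≤_; _<_)
open import Data.Nat.GCD using (gcd)
open import Data.Nat.Divisibility using (_∣_)
open import Data.Rational using () renaming (_+_ to _+ℚ_)
open import Relation.Nullary using (¬_)
open import Relation.Binary.PropositionalEquality using (_≡_; _≢_)

open import Data.Nat using (suc; z≤n; s≤s; _≤?_)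
open import Data.Nat.Properties using (≤-trans)
open import Data.Nat.Divisibility using (_∣?_)
open import Data.Nat.Primality using (Prime; prime?)
open import Data.List using (List; filter; upTo)
open import Data.List.Relation.Unary.All using (All)
import Data.List.Relation.Unary.All as All
open import Data.List.Relation.Unary.All.Properties using (all-filter)
open import Data.Product using (_×_; _,_; proj₁; proj₂)
open import Relation.Nullary.Decidable using (Dec; _×-dec_)
open import Relation.Binary.PropositionalEquality using (subst₂; sym)
open import Function using (id)
open Counting using (listProd; listProd-filter-upTo)
open AbundancyBound using (abundancy-bound)
open ExponentialBound using (logLt-from-product)
open TotientEquation using (totient-equation-bound)

lemma4p1 : (x y z m n : ℕ) →
    y < x → 1 ≤ y → n < m → 1 ≤ n → gcd m n ≡ 1 → ¬ (2 ∣ m) → 2 ∣ n →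
    1 ≤ z → z ≤ x + y → z ≢ 2 → ν₂ x ≡ ν₂ y →
    φ (z * ((x ^ m + y ^ m) div (x + y))) ≡ z * ((x ^ n ∸ y ^ n) div (x + y)) →
    LogLt x (c138 +ℚ sumInvPrimes≥7 (z * ((x ^ m + y ^ m) div (x + y))))
lemma4p1 x y z m n y<x _ n<m _ _ _ _ 1≤z _ _ _ φ≡ = logLt-from-product x large large≥1 25x·∏p≤99·∏[p+1]
  where
  N : ℕ
  N = z * ((x ^ m + y ^ m) div (x + y))
  isLarge? : (p : ℕ) → Dec (Prime p × (7 ≤ p × p ∣ N))
  isLarge? p = prime? p ×-dec (7 ≤? p ×-dec p ∣? N)
  large : List ℕ
  large = filter isLarge? (upTo (suc N))
  large≥1 : All (1 ≤_) large
  large≥1 = All.map (λ p-large → ≤-trans (s≤s z≤n) (proj₁ (proj₂ p-large))) (all-filter isLarge? (upTo (suc N)))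
  25x·∏p≤99·∏[p+1] : x * 25 * listProd id large ≤ 99 * listProd suc large
  25x·∏p≤99·∏[p+1] with totient-equation-bound x y z m n y<x n<m 1≤z φ≡
  ... | xφ≤N , 1≤N = subst₂ (λ u v → x * 25 * u ≤ 99 * v)
                        (sym (listProd-filter-upTo isLarge? id (suc N)))
                        (sym (listProd-filter-upTo isLarge? suc (suc N)))
                        (abundancy-bound N x 1≤N xφ≤N)
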